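{- Let $a$ and $d$ be coprime positive integers. Then there exists exactly one pair of integers $(a',d')$ with $1 \le d' \le d$ such that $$(a+id)(a'+id') \equiv 1 \pmod{a+(i+1)d} \quad \text{for all integers } i \ge 0.$$
   Context: $A(x,y)$ denotes the arithmetic progression $x, x+y, x+2y, \ldots$ with leading term $x$ and common difference $y$. The displayed congruence condition is the paper's "Property $\mathcal{P}$" relating the progressions $A(a,d)$ and $A(a',d')$, so the claim is that for a given progression $A(a,d)$ there is exactly one progression $A(a',d')$ with $1\le d'\le d$ connected to it by Property $\mathcal{P}$. -}

module Defs where

open import Data.Nat using (ℕ; suc)
open import Data.Integer using (ℤ; +_; _+_; _*_; _-_; 1ℤ)
open import Data.Integer.Divisibility using (_∣_)

_≡_[mod_] : ℤ → ℤ → ℤ → Set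
x ≡ y [mod m ] = m ∣ (x - y)

PropertyP : ℤ → ℤ → ℤ → ℤ → Set
PropertyP a d a' d' =
  (i : ℕ) → ((a + (+ i) * d) * (a' + (+ i) * d')) ≡ 1ℤ [mod (a + (+ (suc i)) * d) ]

{-# OPTIONS --safe #-}
-- Expanding the product gives
--   (a + i d)(a' + i d') - 1 = δ + (a + (i+1) d)(a' + (i-1) d'),   δ = (a + d) d' - d a' - 1,
-- so Property P says that every modulus a + (i+1) d divides the defect δ; taking i = |δ|
-- makes the modulus exceed |δ|, hence P holds iff the determinant (a + d) d' - d a' is 1.
-- That equation says a d' ≡ 1 (mod d) and then determines a'; since a is invertible
-- modulo d, d' exists and is unique in [1, d].
module Submission where

open import Defs
open import Data.Nat using (ℕ; _<_)
open import Data.Nat.Coprimality using (Coprime)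
open import Data.Integer using (ℤ; +_; _≤_)
open import Data.Product using (Σ; _×_; _,_)
open import Relation.Binary.PropositionalEquality using (_≡_)

open import Data.Nat as ℕ using (suc; NonZero; z≤n; s≤s)
import Data.Nat.Properties as ℕ
import Data.Nat.Divisibility as ℕ
open import Data.Nat.GCD using (module Bézout)
import Data.Nat.Coprimality as ℕ using (sym; coprime-+; coprime-Bézout)
open import Data.Integer using (_+_; _*_; _-_; -_; 0ℤ; 1ℤ; ∣_∣; _⊖_; +≤+; _/_; _%_)
open import Data.Integer.Properties
  using (pos-*; m-n≡m⊖n; [1+m]⊖[1+n]≡m⊖n; ∣m⊝n∣≤m⊔n; ∣i∣≡0⇒i≡0; i≡j⇒i-j≡0; i-j≡0⇒i≡j;
         *-zeroʳ; *-cancelˡ-≡; +-identityˡ; +-assoc)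
open import Data.Integer.Divisibility using (_∣_)
import Data.Integer.Divisibility.Signed as Signed
import Data.Integer.Coprimality as ℤ using (coprime-divisor)
open import Data.Integer.DivMod using (a≡a%n+[a/n]*n; n%d<d)
open import Data.Integer.Tactic.RingSolver using (solve-∀; solve)
open import Data.List.Base using (_∷_; [])
open import Data.Product using (∃₂)
open import Relation.Binary.PropositionalEquality
  using (refl; sym; trans; cong; cong₂; subst; module ≡-Reasoning)
open import Relation.Nullary using (contradiction)

∣∧<⇒≡0 : ∀ {m n} → m ℕ.∣ n → n < m → n ≡ 0
∣∧<⇒≡0 {n = 0}     _   _   = refl
∣∧<⇒≡0 {n = suc _} m∣n n<m = contradiction m∣n (ℕ.>⇒∤ n<m)

∣i-j∣<d : ∀ {d i j} → + 1 ≤ i → i ≤ + d → + 1 ≤ j → j ≤ + d → ∣ i - j ∣ < d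
∣i-j∣<d {d} (+≤+ (s≤s {n = m} z≤n)) (+≤+ m<d) (+≤+ (s≤s {n = n} z≤n)) (+≤+ n<d) = begin-strict
  ∣ + suc m - + suc n ∣ ≡⟨ cong ∣_∣ (trans (m-n≡m⊖n (suc m) (suc n)) ([1+m]⊖[1+n]≡m⊖n m n)) ⟩
  ∣ m ⊖ n ∣             ≤⟨ ∣m⊝n∣≤m⊔n m n ⟩
  m ℕ.⊔ n               <⟨ ℕ.⊔-lub m<d n<d ⟩
  d                     ∎
  where open ℕ.≤-Reasoning

≡-mod⇒≡ : ∀ {d i j} → + 1 ≤ i → i ≤ + d → + 1 ≤ j → j ≤ + d → i ≡ j [mod + d ] → i ≡ j
≡-mod⇒≡ 1≤i i≤d 1≤j j≤d d∣i-j =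
  i-j≡0⇒i≡j _ _ (∣i∣≡0⇒i≡0 (∣∧<⇒≡0 d∣i-j (∣i-j∣<d 1≤i i≤d 1≤j j≤d)))

product-shift : ∀ a d a' d' i →
  (a + i * d) * (a' + i * d') - 1ℤ ≡
  ((a + d) * d' - d * a' - 1ℤ) + (a' + (i - 1ℤ) * d') * (a + (1ℤ + i) * d)
product-shift = solve-∀

det≡1⇒PropertyP : ∀ a d a' d' → (a + d) * d' - d * a' ≡ 1ℤ → PropertyP a d a' d'
det≡1⇒PropertyP a d a' d' det≡1 i = Signed.∣⇒∣ᵤ (Signed.divides (a' + (+ i - 1ℤ) * d') (begin
  (a + + i * d) * (a' + + i * d') - 1ℤ ≡⟨ product-shift a d a' d' (+ i) ⟩
  ((a + d) * d' - d * a' - 1ℤ) + q * m ≡⟨ cong (_+ q * m) (i≡j⇒i-j≡0 det≡1) ⟩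
  0ℤ + q * m                           ≡⟨ +-identityˡ (q * m) ⟩
  q * m                                ∎))
  where
  open ≡-Reasoning
  m = a + (+ suc i) * d
  q = a' + (+ i - 1ℤ) * d'

PropertyP⇒∣defect : ∀ {a d a' d'} → PropertyP a d a' d' →
  ∀ i → (a + (+ suc i) * d) ∣ ((a + d) * d' - d * a' - 1ℤ)
PropertyP⇒∣defect {a} {d} {a'} {d'} P i = Signed.∣⇒∣ᵤ (Signed.∣m+n∣n⇒∣m {m = δ}
  (subst (Signed._∣_ m) (product-shift a d a' d' (+ i)) (Signed.∣ᵤ⇒∣ {m} (P i)))
  (Signed.∣n⇒∣m*n q Signed.∣-refl))
  where
  m = a + (+ suc i) * d
  q = a' + (+ i - 1ℤ) * d'
  δ = (a + d) * d' - d * a' - 1ℤ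

PropertyP⇒det≡1 : ∀ a d {a' d'} .{{_ : NonZero d}} → PropertyP (+ a) (+ d) a' d' →
  (+ a + + d) * d' - + d * a' ≡ 1ℤ
PropertyP⇒det≡1 a d {a'} {d'} P =
  i-j≡0⇒i≡j _ _ (∣i∣≡0⇒i≡0 (∣∧<⇒≡0 modulus∣n n<modulus))
  where
  n = ∣ (+ a + + d) * d' - + d * a' - 1ℤ ∣
  modulus∣n : a ℕ.+ suc n ℕ.* d ℕ.∣ n
  modulus∣n = subst (ℕ._∣ n) (cong (λ m → ∣ + a + m ∣) (sym (pos-* (suc n) d)))
                    (PropertyP⇒∣defect {+ a} {+ d} {a'} {d'} P n)
  n<modulus : n < a ℕ.+ suc n ℕ.* d
  n<modulus = ℕ.≤-trans (ℕ.m≤m*n (suc n) d) (ℕ.m≤n+m _ a)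

pos-1+*≡* : ∀ x m y n → 1 ℕ.+ x ℕ.* m ≡ y ℕ.* n → 1ℤ + + x * + m ≡ + y * + n
pos-1+*≡* x m y n eq =
  trans (cong (_+_ 1ℤ) (sym (pos-* x m))) (trans (cong +_ eq) (pos-* y n))

bézout : ∀ {a d} → Coprime a d → ∃₂ λ u k → u * + a ≡ 1ℤ + k * + d
bézout {a} {d} coprime with ℕ.coprime-Bézout coprime
... | Bézout.+- x y eq = + x , + y , sym (pos-1+*≡* y d x a eq)
... | Bézout.-+ x y eq = - + x , - + y , negate (+ x) (+ a) (+ y) (+ d) (pos-1+*≡* x a y d eq)
  where
  negate : ∀ x a y d → 1ℤ + x * a ≡ y * d → - x * a ≡ 1ℤ + - y * d
  negate x a y d eq = i-j≡0⇒i≡j _ _ (begin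
    - x * a - (1ℤ + - y * d) ≡⟨ solve (x ∷ a ∷ y ∷ d ∷ []) ⟩
    y * d - (1ℤ + x * a)     ≡⟨ i≡j⇒i-j≡0 (sym eq) ⟩
    0ℤ                       ∎)
    where open ≡-Reasoning

shifted-divMod : ∀ u d .{{_ : NonZero d}} → ∃₂ λ r q → (+ 1 ≤ r × r ≤ + d) × u ≡ r + q * + d
shifted-divMod u d = + suc r , q , (+≤+ (s≤s z≤n) , +≤+ (n%d<d (u - 1ℤ) (+ d))) , (begin
  u                       ≡⟨ solve (u ∷ []) ⟩
  1ℤ + (u - 1ℤ)           ≡⟨ cong (_+_ 1ℤ) (a≡a%n+[a/n]*n (u - 1ℤ) (+ d)) ⟩
  1ℤ + (+ r + q * + d)    ≡⟨ +-assoc 1ℤ (+ r) (q * + d) ⟨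
  + suc r + q * + d       ∎)
  where
  open ≡-Reasoning
  r = (u - 1ℤ) % + d
  q = (u - 1ℤ) / + d

inverse-shift : ∀ a d u k r q → u * a ≡ 1ℤ + k * d → u ≡ r + q * d →
                a * r ≡ 1ℤ + (k - a * q) * d
inverse-shift a d u k r q ua≡1+kd u≡r+qd = i-j≡0⇒i≡j _ _ (begin
  a * r - (1ℤ + (k - a * q) * d)                 ≡⟨ solve (a ∷ d ∷ u ∷ k ∷ r ∷ q ∷ []) ⟩
  (u * a - (1ℤ + k * d)) - a * (u - (r + q * d))
    ≡⟨ cong₂ (λ s t → s - a * t) (i≡j⇒i-j≡0 ua≡1+kd) (i≡j⇒i-j≡0 u≡r+qd) ⟩
  0ℤ - a * 0ℤ                                    ≡⟨ cong (_-_ 0ℤ) (*-zeroʳ a) ⟩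
  0ℤ                                             ∎)
  where open ≡-Reasoning

inverse-in-[1,d] : ∀ {a d} → Coprime a d → .{{_ : NonZero d}} →
  ∃₂ λ r t → (+ 1 ≤ r × r ≤ + d) × + a * r ≡ 1ℤ + t * + d
inverse-in-[1,d] {a} {d} coprime =
  let u , k , ua≡1+kd = bézout coprime
      r , q , bounds , u≡r+qd = shifted-divMod u d
  in r , k - + a * q , bounds , inverse-shift (+ a) (+ d) u k r q ua≡1+kd u≡r+qd

det≡1-from-inverse : ∀ a d r t → a * r ≡ 1ℤ + t * d → (a + d) * r - d * (t + r) ≡ 1ℤ
det≡1-from-inverse a d r t ar≡1+td = i-j≡0⇒i≡j _ _ (begin
  (a + d) * r - d * (t + r) - 1ℤ ≡⟨ solve (a ∷ d ∷ r ∷ t ∷ []) ⟩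
  a * r - (1ℤ + t * d)           ≡⟨ i≡j⇒i-j≡0 ar≡1+td ⟩
  0ℤ                             ∎)
  where open ≡-Reasoning

det≡1-solvable : ∀ {a d} → Coprime a d → .{{_ : NonZero d}} →
  ∃₂ λ a' d' → (+ 1 ≤ d' × d' ≤ + d) × (+ a + + d) * d' - + d * a' ≡ 1ℤ
det≡1-solvable {a} {d} coprime =
  let r , t , bounds , ar≡1+td = inverse-in-[1,d] coprime
  in t + r , r , bounds , det≡1-from-inverse (+ a) (+ d) r t ar≡1+td

cross-multiply : ∀ m n x y x' y' → m * x - n * y ≡ m * x' - n * y' →
                 m * (x - x') ≡ n * (y - y')
cross-multiply m n x y x' y' eq = i-j≡0⇒i≡j _ _ (begin
  m * (x - x') - n * (y - y')         ≡⟨ solve (m ∷ n ∷ x ∷ y ∷ x' ∷ y' ∷ []) ⟩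
  (m * x - n * y) - (m * x' - n * y') ≡⟨ i≡j⇒i-j≡0 eq ⟩
  0ℤ                                  ∎)
  where open ≡-Reasoning

det≡1-unique : ∀ {a d a₁ d₁ a₂ d₂} → Coprime a d → .{{_ : NonZero d}} →
  + 1 ≤ d₁ → d₁ ≤ + d → + 1 ≤ d₂ → d₂ ≤ + d →
  (+ a + + d) * d₁ - + d * a₁ ≡ 1ℤ → (+ a + + d) * d₂ - + d * a₂ ≡ 1ℤ →
  a₁ ≡ a₂ × d₁ ≡ d₂
det≡1-unique {a} {d} {a₁} {d₁} {a₂} {d₂} coprime 1≤d₁ d₁≤d 1≤d₂ d₂≤d det₁≡1 det₂≡1 =
  a₁≡a₂ , d₁≡d₂
  where
  open ≡-Reasoning
  cross : (+ a + + d) * (d₁ - d₂) ≡ + d * (a₁ - a₂)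
  cross = cross-multiply (+ a + + d) (+ d) d₁ a₁ d₂ a₂ (trans det₁≡1 (sym det₂≡1))
  coprime′ : Coprime d (a ℕ.+ d)
  coprime′ = subst (Coprime d) (ℕ.+-comm d a) (ℕ.sym (ℕ.coprime-+ coprime))
  d∣[a+d][d₁-d₂] : + d ∣ (+ a + + d) * (d₁ - d₂)
  d∣[a+d][d₁-d₂] =
    subst (+ d ∣_) (sym cross) (Signed.∣⇒∣ᵤ {+ d} (Signed.∣m⇒∣m*n (a₁ - a₂) Signed.∣-refl))
  d₁≡d₂ : d₁ ≡ d₂
  d₁≡d₂ = ≡-mod⇒≡ 1≤d₁ d₁≤d 1≤d₂ d₂≤d
            (ℤ.coprime-divisor (+ d) (+ a + + d) (d₁ - d₂) coprime′ d∣[a+d][d₁-d₂])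
  a₁≡a₂ : a₁ ≡ a₂
  a₁≡a₂ = i-j≡0⇒i≡j _ _ (*-cancelˡ-≡ (+ d) (a₁ - a₂) 0ℤ (begin
    + d * (a₁ - a₂)         ≡⟨ cross ⟨
    (+ a + + d) * (d₁ - d₂) ≡⟨ cong (_*_ (+ a + + d)) (i≡j⇒i-j≡0 d₁≡d₂) ⟩
    (+ a + + d) * 0ℤ        ≡⟨ *-zeroʳ (+ a + + d) ⟩
    0ℤ                      ≡⟨ *-zeroʳ (+ d) ⟨
    + d * 0ℤ                ∎))

lemma1 : (a d : ℕ) → 0 < a → 0 < d → Coprime a d →
  Σ ℤ (λ a' → Σ ℤ (λ d' →
    ((+ 1 ≤ d') × (d' ≤ + d)) × PropertyP (+ a) (+ d) a' d' ×
    ((a'' d'' : ℤ) → (+ 1 ≤ d'') × (d'' ≤ + d) → PropertyP (+ a) (+ d) a'' d'' →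
      (a'' ≡ a') × (d'' ≡ d'))))
lemma1 a d _ 0<d coprime =
  let a' , d' , (1≤d' , d'≤d) , det≡1 = det≡1-solvable coprime
  in a' , d' , (1≤d' , d'≤d) , det≡1⇒PropertyP (+ a) (+ d) a' d' det≡1 ,
     λ { a'' d'' (1≤d'' , d''≤d) P →
         det≡1-unique coprime 1≤d'' d''≤d 1≤d' d'≤d (PropertyP⇒det≡1 a d P) det≡1 }
  where
  instance
    d≢0 : NonZero d
    d≢0 = ℕ.>-nonZero 0<d
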